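{- Let $m,n\ge1$, let $G=G_{m\times n}$, let $d=\gcd(m+1,n+1)$ and let $v=(a,b)$ be a vertex of $G$. If $d\nmid a$ and $d\nmid b$, then there is a (not necessarily closed) 180-degree trail at $v$.
   Context: $G_{m\times n}=P_m\square P_n$ is the grid graph with vertex set $[m]\times[n]$, $(i,j)\sim(i',j')$ iff $|i-i'|+|j-j'|=1$, embedded in $R=[0,m+1]\times[0,n+1]$. A ray from a vertex $v$ leaves $v$ in one of the four diagonal directions $(\pm1,\pm1)$ and travels in a straight line, reflecting off the sides of $R$ in the usual manner (on a vertical side the $x$-component of the direction flips, on a horizontal side the $y$-component flips); it stops when it hits a corner of $R$ or returns to $v$. A trail at $v$ is the collection of straight line segments traced by a single ray from $v$ or by two rays from $v$ in different directions. Only trails with exactly two straight line segments touching $v$ are considered; such a trail is a 180-degree trail if these two segments are collinear at $v$ (angle $180^\circ$), and a 90-degree trail if they meet at a right angle. A trail is open if both of its ends go to corners of $R$, and closed otherwise. -}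

module Defs where

open import Data.Bool using (Bool; true; false; not; _∨_; if_then_else_)
open import Data.Nat using (ℕ; zero; suc; _<_; _≡ᵇ_; pred)
open import Data.Product using (_×_; _,_; Σ; ∃; proj₁; proj₂)
open import Data.Sum using (_⊎_)
open import Relation.Binary.PropositionalEquality using (_≡_; _≢_)
open import Relation.Nullary using (¬_)
open import Function.Bundles using (_⇔_)

-- A diagonal direction (dx , dy): true = +1, false = -1.
Dir : Set
Dir = Bool × Bool

opp : Dir → Dir
opp (dx , dy) = (not dx , not dy)

-- Points of the integer lattice inside R = [0,m+1] × [0,n+1].
Point : Set
Point = ℕ × ℕ

-- A ray state: current lattice point and current direction of travel
-- (already reflected if the point lies on a side of R).
State : Set
State = Point × Dir

move : Bool → ℕ → ℕ
move true  x = suc x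
move false x = pred x

reflect : ℕ → Bool → ℕ → Bool
reflect size d x' = if (x' ≡ᵇ 0) ∨ (x' ≡ᵇ suc size) then not d else d

step : ℕ → ℕ → State → State
step m n ((x , y) , (dx , dy)) =
  let x' = move dx x
      y' = move dy y
  in ((x' , y') , (reflect m dx x' , reflect n dy y'))

iter : ℕ → ℕ → ℕ → State → State
iter m n zero    s = s
iter m n (suc k) s = step m n (iter m n k s)

pos : State → Point
pos = proj₁

dir : State → Dir
dir = proj₂

Corner : ℕ → ℕ → Point → Set
Corner m n (x , y) = (x ≡ 0 ⊎ x ≡ suc m) × (y ≡ 0 ⊎ y ≡ suc n)

rayAt : ℕ → ℕ → Point → Dir → ℕ → State
rayAt m n v d k = iter m n k (v , d)

RunsUntil : ℕ → ℕ → Point → Dir → ℕ → Set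
RunsUntil m n v d k =
  ∀ j → 0 < j → j < k →
    (pos (rayAt m n v d j) ≢ v) × ¬ Corner m n (pos (rayAt m n v d j))

data Outcome : Set where
  corner : Outcome
  back   : Dir → Outcome

RayOutcome : ℕ → ℕ → Point → Dir → Outcome → Set
RayOutcome m n v d corner =
  Σ ℕ λ k → 0 < k × RunsUntil m n v d k × Corner m n (pos (rayAt m n v d k))
RayOutcome m n v d (back e) =
  Σ ℕ λ j → RunsUntil m n v d (suc j) × pos (rayAt m n v d (suc j)) ≡ v
            × dir (rayAt m n v d j) ≡ e

data Trail (m n : ℕ) (v : Point) : Set where
  one : (d : Dir) (o : Outcome) → RayOutcome m n v d o → Trail m n v
  two : (d₁ d₂ : Dir) → d₁ ≢ d₂ → (o₁ o₂ : Outcome) →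
        RayOutcome m n v d₁ o₁ → RayOutcome m n v d₂ o₂ → Trail m n v

-- Directions (leaving v) of the straight segments of a single ray that touch v:
-- the first segment, and, if the ray returns arriving with direction e, the last one
-- (which leaves v in direction opp e).
RaySegAt : Dir → Outcome → Dir → Set
RaySegAt d corner   δ = δ ≡ d
RaySegAt d (back e) δ = δ ≡ d ⊎ δ ≡ opp e

-- A segment touching v is determined by the direction in which it leaves v.
TouchesAt : ∀ {m n v} → Trail m n v → Dir → Set
TouchesAt (one d o _) δ = RaySegAt d o δ
TouchesAt (two d₁ d₂ _ o₁ o₂ _ _) δ = RaySegAt d₁ o₁ δ ⊎ RaySegAt d₂ o₂ δ

-- exactly two segments touch v, and they are collinear at v (angle 180°)
Is180 : ∀ {m n v} → Trail m n v → Set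
Is180 t = Σ Dir λ δ → ∀ δ' → TouchesAt t δ' ⇔ (δ' ≡ δ ⊎ δ' ≡ opp δ)

{-# OPTIONS --safe #-}
module Submission where

-- Unfolding the reflections, each coordinate of a ray is a triangle wave: the x-coordinate
-- at time k is the point u + k of the circle ℤ/2(m+1) folded onto [0, m+1], for a start u
-- with u ≡ ±a. So the ray from v = (a, b) in direction d stops at some first time k. If it
-- is then back at v, each coordinate has either kept its direction (2(m+1) ∣ k) or reversed
-- it (2(m+1) ∣ 2u + k). Exactly one reversal forces gcd(m+1, n+1) to divide a or b; two
-- reversals put the ray in a corner at time k/2 < k. Hence the ray either ends in a corner
-- or returns to v in its initial direction, forming a 180° trail by itself; and if the rays
-- in directions d and -d both end in corners, together they form a 180° trail.

open import Defs
open import Data.Bool using (Bool; true; false; not; if_then_else_)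
open import Data.Bool.Properties using (not-¬)
open import Data.Nat
  using (ℕ; zero; suc; _+_; _*_; _∸_; _≤_; _<_; _<?_; _≟_; _≡ᵇ_; pred; s≤s; s≤s⁻¹; z≤n; z<s; NonZero)
open import Data.Nat.Properties
open import Data.Nat.DivMod
  using (_%_; _/_; m%n<n; m<n⇒m%n≡m; n%n≡0; %-distribˡ-+; [m+kn]%n≡m%n; m≡m%n+[m/n]*n)
open import Data.Nat.Divisibility
  using (_∣_; divides; m%n≡0⇒n∣m; %-presˡ-∣; ∣m+n∣m⇒∣n; m∣m*n; n∣m*n; ∣-trans; *-monoʳ-∣; *-cancelˡ-∣)
open import Data.Nat.GCD using (gcd; gcd[m,n]∣m; gcd[m,n]∣n)
open import Data.Nat.Tactic.RingSolver using (solve-∀)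
open import Data.Product using (Σ; ∃; _×_; _,_; proj₁; proj₂)
open import Data.Product.Properties using (≡-dec)
open import Data.Sum using (_⊎_; inj₁; inj₂; [_,_]′)
open import Function using (id; _∘_)
open import Function.Bundles using (mk⇔)
open import Relation.Nullary using (¬_; Dec; yes; no; contradiction)
open import Relation.Nullary.Decidable using (_×-dec_; _⊎-dec_)
open import Relation.Unary using (Decidable)
open import Relation.Binary.PropositionalEquality

Bounce : Set
Bounce = ℕ × Bool

bounce : ℕ → Bounce → Bounce
bounce m (x , d) = move d x , reflect m d (move d x)

pair : Bounce → Bounce → State
pair (x , dx) (y , dy) = (x , y) , (dx , dy)

<⇒≡ᵇ-false : ∀ {x y} → x < y → (x ≡ᵇ y) ≡ false
<⇒≡ᵇ-false {zero}  {suc _} _         = refl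
<⇒≡ᵇ-false {suc x} {suc y} (s≤s x<y) = <⇒≡ᵇ-false x<y

≡ᵇ-refl : ∀ x → (x ≡ᵇ x) ≡ true
≡ᵇ-refl zero    = refl
≡ᵇ-refl (suc x) = ≡ᵇ-refl x

reflect-interior : ∀ m d {x} → 1 ≤ x → x ≤ m → reflect m d x ≡ d
reflect-interior m d {suc x} _ x<m = cong (λ c → if c then not d else d) (<⇒≡ᵇ-false x<m)

reflect-top : ∀ m d → reflect m d (suc m) ≡ not d
reflect-top m d = cong (λ c → if c then not d else d) (≡ᵇ-refl m)

period : ℕ → ℕ
period m = 2 * suc m

period∸suc : ∀ m → period m ∸ suc m ≡ suc m
period∸suc m = trans (m+n∸m≡n (suc m) (suc m + 0)) (+-identityʳ (suc m))

suc<period : ∀ m → suc m < period m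
suc<period m = m<m+n (suc m) (s≤s z≤n)

≤-period : ∀ {x m} → x ≤ m → x ≤ period m
≤-period {m = m} x≤m = ≤-trans x≤m (<⇒≤ (<-trans (n<1+n m) (suc<period m)))

-- Folds the circle ℤ/2(m+1), represented by r < period m, onto the segment [0, m+1]:
-- the rising half is traversed upwards, the falling half downwards.
fold : ℕ → ℕ → Bounce
fold m r with r <? suc m
... | yes _ = r , true
... | no _  = period m ∸ r , false

fold-rising : ∀ m {r} → r ≤ m → fold m r ≡ (r , true)
fold-rising m {r} r≤m with r <? suc m
... | yes _   = refl
... | no r≰m = contradiction (s≤s r≤m) r≰m

fold-falling : ∀ m {r} → suc m ≤ r → fold m r ≡ (period m ∸ r , false)
fold-falling m {r} m<r with r <? suc m
... | yes r≤m = contradiction m<r (<⇒≱ r≤m)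
... | no _    = refl

bounce-rising : ∀ m {r} → r ≤ m → bounce m (r , true) ≡ fold m (suc r)
bounce-rising m {r} r≤m with m≤n⇒m<n∨m≡n r≤m
... | inj₁ r<m = begin
  (suc r , reflect m true (suc r)) ≡⟨ cong (suc r ,_) (reflect-interior m true (s≤s z≤n) r<m) ⟩
  (suc r , true)                   ≡⟨ fold-rising m r<m ⟨
  fold m (suc r)                   ∎
  where open ≡-Reasoning
... | inj₂ refl = begin
  (suc m , reflect m true (suc m)) ≡⟨ cong₂ _,_ (sym (period∸suc m)) (reflect-top m true) ⟩
  (period m ∸ suc m , false)       ≡⟨ fold-falling m ≤-refl ⟨
  fold m (suc m)                   ∎
  where open ≡-Reasoning

bounce-falling : ∀ m {r} → suc m ≤ r → r < period m →
                 bounce m (period m ∸ r , false) ≡ fold m (suc r % period m)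
bounce-falling m {r} m<r r<T with m≤n⇒m<n∨m≡n r<T
... | inj₁ 1+r<T = begin
  (pred (T ∸ r) , reflect m false (pred (T ∸ r)))
    ≡⟨ cong (λ x → x , reflect m false x) (pred[m∸n]≡m∸[1+n] T r) ⟩
  (T ∸ suc r , reflect m false (T ∸ suc r))
    ≡⟨ cong (T ∸ suc r ,_) (reflect-interior m false (m<n⇒0<n∸m 1+r<T) T∸[1+r]≤m) ⟩
  (T ∸ suc r , false) ≡⟨ fold-falling m (m≤n⇒m≤1+n m<r) ⟨
  fold m (suc r)      ≡⟨ cong (fold m) (m<n⇒m%n≡m 1+r<T) ⟨
  fold m (suc r % T)  ∎
  where
  open ≡-Reasoning
  T = period m
  T∸[1+r]≤m : T ∸ suc r ≤ m
  T∸[1+r]≤m = s≤s⁻¹ (subst (T ∸ suc r <_) (period∸suc m) (∸-monoʳ-< (s≤s m<r) (<⇒≤ 1+r<T)))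
... | inj₂ 1+r≡T = begin
  bounce m (T ∸ r , false) ≡⟨ cong (λ x → bounce m (x , false)) T∸r≡1 ⟩
  (0 , true)               ≡⟨ fold-rising m z≤n ⟨
  fold m 0                 ≡⟨ cong (fold m) (n%n≡0 T) ⟨
  fold m (T % T)           ≡⟨ cong (λ x → fold m (x % T)) 1+r≡T ⟨
  fold m (suc r % T)       ∎
  where
  open ≡-Reasoning
  T = period m
  T∸r≡1 : T ∸ r ≡ 1
  T∸r≡1 = trans (cong (_∸ r) (sym 1+r≡T)) (m+n∸n≡m 1 r)

bounce-fold : ∀ m {r} → r < period m → bounce m (fold m r) ≡ fold m (suc r % period m)
bounce-fold m {r} r<T with r <? suc m
... | yes r<1+m = trans (bounce-rising m (s≤s⁻¹ r<1+m))
                        (cong (fold m) (sym (m<n⇒m%n≡m (<-≤-trans (s≤s r<1+m) (suc<period m)))))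
... | no r≮1+m  = bounce-falling m (≮⇒≥ r≮1+m) r<T

wave : ℕ → ℕ → Bounce
wave m u = fold m (u % period m)

bounce-wave : ∀ m u → bounce m (wave m u) ≡ wave m (suc u)
bounce-wave m u = trans (bounce-fold m (m%n<n u T)) (cong (fold m) (sym suc-%))
  where
  T = period m
  suc-% : suc u % T ≡ suc (u % T) % T
  suc-% = trans (%-distribˡ-+ 1 u T)
                (cong (λ x → (x + u % T) % T) (m<n⇒m%n≡m (≤-<-trans (s≤s z≤n) (suc<period m))))

wave-periodic : ∀ m u k → wave m (u + k * period m) ≡ wave m u
wave-periodic m u k = cong (fold m) ([m+kn]%n≡m%n u k (period m))

unfold : ℕ → Bounce → ℕ
unfold m (x , true)  = x
unfold m (x , false) = period m ∸ x

unfold-wave : ∀ m u → unfold m (wave m u) ≡ u % period m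
unfold-wave m u = unfold-fold (m%n<n u (period m))
  where
  unfold-fold : ∀ {r} → r < period m → unfold m (fold m r) ≡ r
  unfold-fold {r} r<T with r <? suc m
  ... | yes _ = refl
  ... | no _  = m∸[m∸n]≡n (<⇒≤ r<T)

wave-unfold : ∀ m {x} d → 1 ≤ x → x ≤ m → wave m (unfold m (x , d)) ≡ (x , d)
wave-unfold m {x} true 1≤x x≤m =
  trans (cong (fold m) (m<n⇒m%n≡m (<-trans (s≤s x≤m) (suc<period m)))) (fold-rising m x≤m)
wave-unfold m {x} false 1≤x x≤m = begin
  fold m ((T ∸ x) % T) ≡⟨ cong (fold m) (m<n⇒m%n≡m (∸-monoʳ-< 1≤x x≤T)) ⟩
  fold m (T ∸ x)       ≡⟨ fold-falling m 1+m≤T∸x ⟩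
  (T ∸ (T ∸ x) , false) ≡⟨ cong (_, false) (m∸[m∸n]≡n x≤T) ⟩
  (x , false)          ∎
  where
  open ≡-Reasoning
  T = period m
  x≤T : x ≤ T
  x≤T = ≤-period x≤m
  1+m≤T∸x : suc m ≤ T ∸ x
  1+m≤T∸x = subst (_≤ T ∸ x) (period∸suc m) (∸-monoʳ-≤ T (m≤n⇒m≤1+n x≤m))

m%n≡[m+o]%n⇒n∣o : ∀ m o n .{{_ : NonZero n}} → m % n ≡ (m + o) % n → n ∣ o
m%n≡[m+o]%n⇒n∣o m o n eq = ∣m+n∣m⇒∣n (subst (n ∣_) shift (n∣m*n ((m + o) / n))) (n∣m*n (m / n))
  where
  open ≡-Reasoning
  shift : (m + o) / n * n ≡ m / n * n + o
  shift = +-cancelˡ-≡ (m % n) _ _ (begin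
    m % n + (m + o) / n * n       ≡⟨ cong (_+ (m + o) / n * n) eq ⟩
    (m + o) % n + (m + o) / n * n ≡⟨ m≡m%n+[m/n]*n (m + o) n ⟨
    m + o                         ≡⟨ cong (_+ o) (m≡m%n+[m/n]*n m n) ⟩
    m % n + m / n * n + o         ≡⟨ +-assoc (m % n) _ o ⟩
    m % n + (m / n * n + o)       ∎)

m%n+o%n≡n⇒n∣m+o : ∀ m o n .{{_ : NonZero n}} → m % n + o % n ≡ n → n ∣ m + o
m%n+o%n≡n⇒n∣m+o m o n eq = m%n≡0⇒n∣m (m + o) n (begin
  (m + o) % n           ≡⟨ %-distribˡ-+ m o n ⟩
  (m % n + o % n) % n   ≡⟨ cong (_% n) eq ⟩
  n % n                 ≡⟨ n%n≡0 n ⟩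
  0                     ∎)
  where open ≡-Reasoning

-- A coordinate back at the same position x has either kept its direction, after a
-- whole number of periods, or reversed it, at a time symmetric to u about a wall.
wave-revisit : ∀ m u k {x d e} → wave m u ≡ (x , d) → wave m (u + k) ≡ (x , e) →
               (e ≡ d × period m ∣ k) ⊎ period m ∣ u + (u + k)
wave-revisit m u k {x} {d} {e} p q = compare d e (unfold-at {u} p) (unfold-at {u + k} q)
  where
  T = period m
  unfold-at : ∀ {w s} → wave m w ≡ s → w % T ≡ unfold m s
  unfold-at {w} eq = trans (sym (unfold-wave m w)) (cong (unfold m) eq)
  compare : ∀ d e → u % T ≡ unfold m (x , d) → (u + k) % T ≡ unfold m (x , e) →
            (e ≡ d × T ∣ k) ⊎ T ∣ u + (u + k)
  compare true  true  r≡x   s≡x   = inj₁ (refl , m%n≡[m+o]%n⇒n∣o u k T (trans r≡x (sym s≡x)))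
  compare false false r≡T∸x s≡T∸x = inj₁ (refl , m%n≡[m+o]%n⇒n∣o u k T (trans r≡T∸x (sym s≡T∸x)))
  compare true  false r≡x   s≡T∸x = inj₂ (m%n+o%n≡n⇒n∣m+o u (u + k) T (begin
    u % T + (u + k) % T ≡⟨ cong₂ _+_ r≡x s≡T∸x ⟩
    x + (T ∸ x)         ≡⟨ m+[n∸m]≡n (<⇒≤ (subst (_< T) r≡x (m%n<n u T))) ⟩
    T                   ∎))
    where open ≡-Reasoning
  compare false true  r≡T∸x s≡x = inj₂ (m%n+o%n≡n⇒n∣m+o u (u + k) T (begin
    u % T + (u + k) % T ≡⟨ cong₂ _+_ r≡T∸x s≡x ⟩
    (T ∸ x) + x         ≡⟨ m∸n+n≡m (<⇒≤ (subst (_< T) s≡x (m%n<n (u + k) T))) ⟩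
    T                   ∎))
    where open ≡-Reasoning

wave-wall : ∀ m u → suc m ∣ u → proj₁ (wave m u) ≡ 0 ⊎ proj₁ (wave m u) ≡ suc m
wave-wall m u 1+m∣u = fold-wall (m%n<n u (period m)) (%-presˡ-∣ 1+m∣u (n∣m*n 2))
  where
  fold-wall : ∀ {r} → r < period m → suc m ∣ r → proj₁ (fold m r) ≡ 0 ⊎ proj₁ (fold m r) ≡ suc m
  fold-wall _ (divides zero refl) = inj₁ (cong proj₁ (fold-rising m z≤n))
  fold-wall _ (divides (suc zero) refl) = inj₂ (begin
    proj₁ (fold m (suc m + 0)) ≡⟨ cong (proj₁ ∘ fold m) (+-identityʳ (suc m)) ⟩
    proj₁ (fold m (suc m))     ≡⟨ cong proj₁ (fold-falling m ≤-refl) ⟩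
    period m ∸ suc m           ≡⟨ period∸suc m ⟩
    suc m                      ∎)
    where open ≡-Reasoning
  fold-wall r<T (divides (suc (suc q)) refl) =
    contradiction (*-monoˡ-≤ (suc m) (s≤s (s≤s (z≤n {q})))) (<⇒≱ r<T)

∣unfold⇒∣ : ∀ {g m x} d → g ∣ suc m → x ≤ period m → g ∣ unfold m (x , d) → g ∣ x
∣unfold⇒∣ true  _ _ g∣x = g∣x
∣unfold⇒∣ {g} {m} {x} false g∣1+m x≤T g∣T∸x =
  ∣m+n∣m⇒∣n (subst (g ∣_) (sym (m∸n+n≡m x≤T)) (∣-trans g∣1+m (n∣m*n 2))) g∣T∸x

∣-from-reflection : ∀ {g M N u k} → g ∣ M → g ∣ N → 2 * M ∣ u + (u + k) → 2 * N ∣ k → g ∣ u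
∣-from-reflection {g} {u = u} {k} g∣M g∣N 2M∣u+[u+k] 2N∣k =
  *-cancelˡ-∣ 2 (∣m+n∣m⇒∣n (subst (2 * g ∣_) (rearrange u k) 2g∣u+[u+k]) 2g∣k)
  where
  2g∣u+[u+k] = ∣-trans (*-monoʳ-∣ 2 g∣M) 2M∣u+[u+k]
  2g∣k = ∣-trans (*-monoʳ-∣ 2 g∣N) 2N∣k
  rearrange : ∀ u k → u + (u + k) ≡ k + 2 * u
  rearrange = solve-∀

reflection-even : ∀ M u k → 2 * M ∣ u + (u + k) → 2 ∣ k
reflection-even M u k 2M∣u+[u+k] =
  ∣m+n∣m⇒∣n (subst (2 ∣_) (rearrange u k) (∣-trans (m∣m*n M) 2M∣u+[u+k])) (m∣m*n u)
  where
  rearrange : ∀ u k → u + (u + k) ≡ 2 * u + k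
  rearrange = solve-∀

-- Two coordinates both reflected at time k (as in wave-revisit) were both at a wall at time k/2.
reflections-meet : ∀ M N u w k → 0 < k → 2 * M ∣ u + (u + k) → 2 * N ∣ w + (w + k) →
                   ∃ λ h → 0 < h × h < k × M ∣ u + h × N ∣ w + h
reflections-meet M N u w k 0<k 2M∣u+[u+k] 2N∣w+[w+k] with reflection-even M u k 2M∣u+[u+k]
... | divides (suc h) refl = suc h , s≤s z≤n , m<m*n (suc h) 2 ≤-refl ,
                             halve 2M∣u+[u+k] , halve 2N∣w+[w+k]
  where
  halve : ∀ {L t} → 2 * L ∣ t + (t + suc h * 2) → L ∣ t + suc h
  halve {L} {t} = *-cancelˡ-∣ 2 ∘ subst (2 * L ∣_) (double t (suc h))
    where
    double : ∀ t h → t + (t + h * 2) ≡ 2 * (t + h)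
    double = solve-∀

least-witness : ∀ {p} {P : ℕ → Set p} → Decidable P → ∀ n → P n →
                ∃ λ j → P j × (∀ {i} → i < j → ¬ P i)
least-witness {P = P} P? n Pn =
  [ id , (λ none → contradiction Pn (none (n<1+n n))) ]′ (search (suc n))
  where
  search : ∀ N → (∃ λ j → P j × (∀ {i} → i < j → ¬ P i)) ⊎ (∀ {i} → i < N → ¬ P i)
  search zero = inj₂ λ ()
  search (suc N) with search N
  ... | inj₁ found = inj₁ found
  ... | inj₂ none with P? N
  ...   | yes PN  = inj₁ (N , PN , none)
  ...   | no ¬PN = inj₂ λ i<1+N → [ none , (λ { refl → ¬PN }) ]′ (m<1+n⇒m<n∨m≡n i<1+N)

corner? : ∀ m n p → Dec (Corner m n p)
corner? m n (x , y) = ((x ≟ 0) ⊎-dec (x ≟ suc m)) ×-dec ((y ≟ 0) ⊎-dec (y ≟ suc n))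

Interior : ℕ → ℕ → Point → Set
Interior m n (x , y) = (1 ≤ x × x ≤ m) × (1 ≤ y × y ≤ n)

dir-step-into-interior : ∀ m n s → Interior m n (pos (step m n s)) → dir (step m n s) ≡ dir s
dir-step-into-interior m n ((x , y) , (dx , dy)) ((1≤x′ , x′≤m) , (1≤y′ , y′≤n)) =
  cong₂ _,_ (reflect-interior m dx 1≤x′ x′≤m) (reflect-interior n dy 1≤y′ y′≤n)

CornerOrStraightReturn : ℕ → ℕ → Point → Dir → Set
CornerOrStraightReturn m n v d = RayOutcome m n v d corner ⊎ RayOutcome m n v d (back d)

module Ray (m n : ℕ) {a b : ℕ} (1≤a : 1 ≤ a) (a≤m : a ≤ m) (1≤b : 1 ≤ b) (b≤n : b ≤ n)
           (d : Dir) where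

  v : Point
  v = a , b

  v-interior : Interior m n v
  v-interior = (1≤a , a≤m) , (1≤b , b≤n)

  ray : ℕ → State
  ray = rayAt m n v d

  u₁ u₂ : ℕ
  u₁ = unfold m (a , proj₁ d)
  u₂ = unfold n (b , proj₂ d)

  start₁ : wave m u₁ ≡ (a , proj₁ d)
  start₁ = wave-unfold m (proj₁ d) 1≤a a≤m

  start₂ : wave n u₂ ≡ (b , proj₂ d)
  start₂ = wave-unfold n (proj₂ d) 1≤b b≤n

  ray≡waves : ∀ k → ray k ≡ pair (wave m (u₁ + k)) (wave n (u₂ + k))
  ray≡waves zero = sym (cong₂ pair (trans (cong (wave m) (+-identityʳ u₁)) start₁)
                                   (trans (cong (wave n) (+-identityʳ u₂)) start₂))
  ray≡waves (suc k) = begin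
    step m n (ray k)
      ≡⟨ cong (step m n) (ray≡waves k) ⟩
    pair (bounce m (wave m (u₁ + k))) (bounce n (wave n (u₂ + k)))
      ≡⟨ cong₂ pair (bounce-wave m (u₁ + k)) (bounce-wave n (u₂ + k)) ⟩
    pair (wave m (suc (u₁ + k))) (wave n (suc (u₂ + k)))
      ≡⟨ cong₂ pair (cong (wave m) (+-suc u₁ k)) (cong (wave n) (+-suc u₂ k)) ⟨
    pair (wave m (u₁ + suc k)) (wave n (u₂ + suc k)) ∎
    where open ≡-Reasoning

  returns-after-periods : pos (ray (period m * period n)) ≡ v
  returns-after-periods = begin
    pos (ray (period m * period n))
      ≡⟨ cong pos (ray≡waves (period m * period n)) ⟩
    (proj₁ (wave m (u₁ + period m * period n)) , proj₁ (wave n (u₂ + period m * period n)))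
      ≡⟨ cong₂ _,_ (cong (λ t → proj₁ (wave m (u₁ + t))) (*-comm (period m) (period n)))
                   (cong proj₁ (wave-periodic n u₂ (period m))) ⟩
    (proj₁ (wave m (u₁ + period n * period m)) , proj₁ (wave n u₂))
      ≡⟨ cong₂ _,_ (cong proj₁ (trans (wave-periodic m u₁ (period n)) start₁)) (cong proj₁ start₂) ⟩
    v ∎
    where open ≡-Reasoning

  corner-at : ∀ {h} → suc m ∣ u₁ + h → suc n ∣ u₂ + h → Corner m n (pos (ray h))
  corner-at {h} 1+m∣ 1+n∣ =
    subst (Corner m n) (sym (cong pos (ray≡waves h))) (wave-wall m _ 1+m∣ , wave-wall n _ 1+n∣)

  Stop : ℕ → Set
  Stop k = pos (ray k) ≡ v ⊎ Corner m n (pos (ray k))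

  stop? : ∀ k → Dec (Stop k)
  stop? k = ≡-dec _≟_ _≟_ (pos (ray k)) v ⊎-dec corner? m n (pos (ray k))

  runs-before-stops : ∀ {k} → (∀ {i} → i < k → ¬ (0 < i × Stop i)) → RunsUntil m n v d k
  runs-before-stops none i 0<i i<k =
    (λ at-v → none i<k (0<i , inj₁ at-v)) , (λ at-corner → none i<k (0<i , inj₂ at-corner))

  first-stop : ∃ λ k → 0 < k × Stop k × RunsUntil m n v d k
  first-stop with least-witness (λ k → 0 <? k ×-dec stop? k) (period m * period n)
                                (z<s , inj₁ returns-after-periods)
  ... | k , (0<k , stop) , earlier = k , 0<k , stop , runs-before-stops earlier

  module _ {g : ℕ} (g∣1+m : g ∣ suc m) (g∣1+n : g ∣ suc n) (g∤a : ¬ g ∣ a) (g∤b : ¬ g ∣ b) where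

    returns-straight : ∀ {k} → 0 < k → RunsUntil m n v d k → pos (ray k) ≡ v → dir (ray k) ≡ d
    returns-straight {k} 0<k runs at-v
      with wave-revisit m u₁ k start₁ (cong (_, proj₂ X) (cong proj₁ at-v′))
         | wave-revisit n u₂ k start₂ (cong (_, proj₂ Y) (cong proj₂ at-v′))
      where
      X = wave m (u₁ + k)
      Y = wave n (u₂ + k)
      at-v′ : (proj₁ X , proj₁ Y) ≡ v
      at-v′ = trans (cong pos (sym (ray≡waves k))) at-v
    ... | inj₁ (kept₁ , _) | inj₁ (kept₂ , _) =
      trans (cong dir (ray≡waves k)) (cong₂ _,_ kept₁ kept₂)
    ... | inj₂ reflected₁ | inj₁ (_ , T₂∣k) =
      contradiction (∣unfold⇒∣ (proj₁ d) g∣1+m (≤-period a≤m)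
                       (∣-from-reflection g∣1+m g∣1+n reflected₁ T₂∣k)) g∤a
    ... | inj₁ (_ , T₁∣k) | inj₂ reflected₂ =
      contradiction (∣unfold⇒∣ (proj₂ d) g∣1+n (≤-period b≤n)
                       (∣-from-reflection g∣1+n g∣1+m reflected₂ T₁∣k)) g∤b
    ... | inj₂ reflected₁ | inj₂ reflected₂
      with reflections-meet (suc m) (suc n) u₁ u₂ k 0<k reflected₁ reflected₂
    ...   | h , 0<h , h<k , 1+m∣ , 1+n∣ =
      contradiction (corner-at 1+m∣ 1+n∣) (proj₂ (runs h 0<h h<k))

    outcome : CornerOrStraightReturn m n v d
    outcome with first-stop
    ... | k , 0<k , inj₂ at-corner , runs = inj₁ (k , 0<k , runs , at-corner)
    ... | suc j , _ , inj₁ at-v , runs = inj₂ (j , runs , at-v , arrival)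
      where
      arrival : dir (ray j) ≡ d
      arrival = trans (sym (dir-step-into-interior m n (ray j) (subst (Interior m n) (sym at-v) v-interior)))
                      (returns-straight z<s runs at-v)

opp-≢ : ∀ d → d ≢ opp d
opp-≢ (dx , _) d≡opp = not-¬ refl (cong proj₁ d≡opp)

-- In each case the segments at v leave in directions δ and opp δ, so Is180 holds definitionally.
straight-trail : ∀ {m n v} d → CornerOrStraightReturn m n v d → CornerOrStraightReturn m n v (opp d) →
                 Σ (Trail m n v) Is180
straight-trail d (inj₂ returns) _ =
  one d (back d) returns , d , λ _ → mk⇔ id id
straight-trail d (inj₁ _) (inj₂ returns) =
  one (opp d) (back (opp d)) returns , opp d , λ _ → mk⇔ id id
straight-trail d (inj₁ ends) (inj₁ ends′) =
  two d (opp d) (opp-≢ d) corner corner ends ends′ , d , λ _ → mk⇔ id id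

lemma2p5 : (m n : ℕ) → 1 ≤ m → 1 ≤ n → (a b : ℕ) → 1 ≤ a → a ≤ m → 1 ≤ b → b ≤ n →
    ¬ (gcd (m + 1) (n + 1) ∣ a) → ¬ (gcd (m + 1) (n + 1) ∣ b) →
    Σ (Trail m n (a , b)) Is180
lemma2p5 m n _ _ a b 1≤a a≤m 1≤b b≤n g∤a g∤b =
  straight-trail (true , true) (outcome (true , true)) (outcome (false , false))
  where
  g∣1+m : gcd (m + 1) (n + 1) ∣ suc m
  g∣1+m = subst (gcd (m + 1) (n + 1) ∣_) (+-comm m 1) (gcd[m,n]∣m (m + 1) (n + 1))
  g∣1+n : gcd (m + 1) (n + 1) ∣ suc n
  g∣1+n = subst (gcd (m + 1) (n + 1) ∣_) (+-comm n 1) (gcd[m,n]∣n (m + 1) (n + 1))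
  outcome : ∀ d → CornerOrStraightReturn m n (a , b) d
  outcome d = Ray.outcome m n 1≤a a≤m 1≤b b≤n d g∣1+m g∣1+n g∤a g∤b
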